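{- For every integer $g\ge 3$, $(g,g-1)$-reverse multiples exist, and the $(g,g-1)$ Young graph is the 1089 graph.
   Context: Notation: $(a_{n-1},\dots,a_1,a_0)_g$ denotes $\sum_{i=0}^{n-1}a_ig^i$ with digits $0\le a_i<g$. For integers $g\ge3$, $2\le k<g$, a positive integer $N=(a_{n-1},\dots,a_0)_g$ with $a_{n-1}\neq 0$ is a $(g,k)$-reverse multiple if $kN=(a_0,a_1,\dots,a_{n-1})_g$ (the base-$g$ reversal of $N$). Young graph. The directed edge-labelled graph $H(g,k)$ is defined as follows. Its possible nodes are a distinguished starting node, written $[[0,0]]$, and ordered pairs $[s,r]$ of integers with $0\le s,r\le k-1$ (the pair $[0,0]$ is a node distinct from the starting node). For a node $[s,r]$ (the starting node being treated as $s=r=0$) and each pair of digits $(c,a)$, $0\le a,c\le g-1$, with $ka+r\equiv c \pmod g$ and $0\le a+sg-kc\le k-1$, there is a directed edge labelled $(c,a)$ from $[s,r]$ to the node $[\,a+sg-kc,\ (ka+r-c)/g\,]$; for edges leaving the starting node one additionally requires $a\ne0$ and $c\ne0$. $H(g,k)$ consists of the starting node, the nodes reachable from it by directed paths, and all edges leaving these nodes. A non-starting node of the form $[r,r]$ ($r\ge0$, including $[0,0]$) is an even pivot node; a non-starting node is an odd pivot node if it is of the form $[r,r]$ and carries a loop, or is of the form $[r',r]$ with $r'\ne r$ and has an edge to $[r,r']$. The $(g,k)$ Young graph exists if $H(g,k)$ contains a node $[r,r]$ with $r\ne0$ or an edge $[r',r]\to[r,r']$ with $r'\ne r$; it is then obtained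 from $H(g,k)$ by deleting every node from which no pivot node can be reached by a directed path, together with all edges incident to such nodes. Two Young graphs are isomorphic if there is an isomorphism of the underlying (unlabelled) directed graphs sending starting node to starting node, even pivot nodes onto even pivot nodes and odd pivot nodes onto odd pivot nodes. The 1089 graph: a Young graph is "the 1089 graph" if it is isomorphic to the graph with starting node $S$ and non-starting nodes $U,V,W,X$, with edges $S\to V$, $U\to U$, $U\to V$, $V\to W$, $W\to W$, $W\to X$, $X\to U$, in which $U$ and $W$ are both even and odd pivot nodes and $V,X$ are not pivot nodes. -}

module Defs where

open import Data.Nat using (ℕ; zero; suc; _+_; _*_; _∸_; _≤_; _<_)
open import Data.List using (List; []; _∷_; _∷ʳ_; reverse)
open import Data.List.Relation.Unary.All using (All)
open import Data.Product using (Σ; ∃; ∃-syntax; _×_; _,_)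
open import Data.Sum using (_⊎_)
open import Relation.Nullary using (¬_)
open import Relation.Binary.PropositionalEquality using (_≡_; _≢_)
open import Relation.Binary.Construct.Closure.ReflexiveTransitive using (Star)
open import Function.Bundles using (_⇔_)

-- Base-g numerals.  Digit lists are little-endian: the list
-- a₀ ∷ a₁ ∷ … ∷ a_{n-1} ∷ [] has value Σ aᵢ gⁱ = (a_{n-1},…,a₀)_g.

val : ℕ → List ℕ → ℕ
val g []       = 0
val g (x ∷ xs) = x + g * val g xs

IsReverseMultiple : ℕ → ℕ → ℕ → Set
IsReverseMultiple g k N =
  Σ (List ℕ) λ ds → Σ ℕ λ d →
    All (_< g) (ds ∷ʳ d) × d ≢ 0 ×
    N ≡ val g (ds ∷ʳ d) × k * N ≡ val g (reverse (ds ∷ʳ d))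

data Node : Set where
  start : Node
  pair  : ℕ → ℕ → Node

sOf : Node → ℕ
sOf start      = 0
sOf (pair s r) = s

rOf : Node → ℕ
rOf start      = 0
rOf (pair s r) = r

-- The conditions k a + r ≡ c (mod g) and target r-coordinate (k a + r − c)/g
-- are expressed by k a + r = c + q g with target r-coordinate q; the
-- target s-coordinate t = a + s g − k c is expressed by a + s g = k c + t,
-- with 0 ≤ t ≤ k − 1.
Edge : ℕ → ℕ → Node → ℕ → ℕ → Node → Set
Edge g k x c a y =
  a < g × c < g × (x ≡ start → a ≢ 0 × c ≢ 0) ×
  Σ ℕ λ t → Σ ℕ λ q →
    y ≡ pair t q × t ≤ k ∸ 1 ×
    k * a + rOf x ≡ c + q * g × a + sOf x * g ≡ k * c + t

Adj : ℕ → ℕ → Node → Node → Set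
Adj g k x y = Σ ℕ λ c → Σ ℕ λ a → Edge g k x c a y

Path : ℕ → ℕ → Node → Node → Set
Path g k = Star (Adj g k)

InH : ℕ → ℕ → Node → Set
InH g k x = Path g k start x

EvenPivot : ℕ → ℕ → Node → Set
EvenPivot g k x = InH g k x × ∃[ r ] x ≡ pair r r

OddPivot : ℕ → ℕ → Node → Set
OddPivot g k x = InH g k x ×
  ((∃[ r ] (x ≡ pair r r × Adj g k x x)) ⊎
   (∃[ r′ ] ∃[ r ] (r′ ≢ r × x ≡ pair r′ r × Adj g k x (pair r r′))))

Pivot : ℕ → ℕ → Node → Set
Pivot g k x = EvenPivot g k x ⊎ OddPivot g k x

YoungExists : ℕ → ℕ → Set
YoungExists g k =
  (∃[ r ] (r ≢ 0 × InH g k (pair r r))) ⊎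
  (∃[ r′ ] ∃[ r ] (r′ ≢ r × InH g k (pair r′ r) × Adj g k (pair r′ r) (pair r r′)))

-- Nodes of the Young graph: nodes of H from which a pivot node is reachable.
-- Its edges are the edges of H between two such nodes.
InYoung : ℕ → ℕ → Node → Set
InYoung g k x = InH g k x × ∃[ y ] (Path g k x y × Pivot g k y)

data N1089 : Set where
  S U V W X : N1089

data E1089 : N1089 → N1089 → Set where
  SV : E1089 S V
  UU : E1089 U U
  UV : E1089 U V
  VW : E1089 V W
  WW : E1089 W W
  WX : E1089 W X
  XU : E1089 X U

data Even1089 : N1089 → Set where
  evU : Even1089 U
  evW : Even1089 W

data Odd1089 : N1089 → Set where
  odU : Odd1089 U
  odW : Odd1089 W

IsThe1089Graph : ℕ → ℕ → Set
IsThe1089Graph g k =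
  Σ (N1089 → Node) λ f →
    (∀ i → InYoung g k (f i)) ×
    (∀ i j → f i ≡ f j → i ≡ j) ×
    (∀ x → InYoung g k x → ∃[ i ] f i ≡ x) ×
    (∀ i j → E1089 i j ⇔ Adj g k (f i) (f j)) ×
    f S ≡ start ×
    (∀ i → Even1089 i ⇔ EvenPivot g k (f i)) ×
    (∀ i → Odd1089 i ⇔ OddPivot g k (f i))

-- For k = g − 1 the two equations of an edge [s,r] → [t,q] labelled (c,a) combine into
-- the base-g expansions  r + a g = (a + c) + q g  and  (a + c) + s g = t + c g.
-- Comparing digits gives t = r and, according as the digit sum a + c is below g
-- or not, either r = s + q or r + k = s + q + 1.  From [[0,0]] only the second
-- case is possible, and following these two rules from [0,k−1] visits exactly
-- [k−1,k−1], [k−1,0] and [0,0]: the 1089 graph with U = [0,0] and W = [k−1,k−1].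
-- The reverse multiple is (1,0,k−1,k)_g, the analogue of 1089 · 9 = 9801.

module Submission where

open import Defs
open import Data.Nat using (ℕ; zero; suc; _+_; _*_; _∸_; _≤_; _<_; z≤n; s≤s; z<s; s<s; s≤s⁻¹; NonZero; _<?_)
open import Data.Nat.Properties
open import Data.Nat.DivMod using (_%_; [m+kn]%n≡m%n; m<n⇒m%n≡m)
open import Data.Nat.Tactic.RingSolver using (solve)
open import Data.List using ([]; _∷_)
open import Data.List.Relation.Unary.All as All using (All)
open import Data.Product using (_×_; ∃-syntax; _,_; proj₂)
open import Data.Sum using (inj₁; inj₂)
open import Data.Empty using (⊥-elim)
open import Function.Bundles using (_⇔_; mk⇔; Equivalence)
open import Relation.Nullary using (yes; no)
open import Relation.Binary.PropositionalEquality
open import Relation.Binary.Construct.Closure.ReflexiveTransitive using (ε; _◅_; fold)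

divMod-unique : ∀ {g} .{{_ : NonZero g}} {a b c d} → a < g → c < g →
                a + b * g ≡ c + d * g → a ≡ c × b ≡ d
divMod-unique {g} {a} {b} {c} {d} a<g c<g eq = a≡c , *-cancelʳ-≡ b d g (+-cancelˡ-≡ a _ _ eq′)
  where
  open ≡-Reasoning
  a≡c : a ≡ c
  a≡c = begin
    a               ≡⟨ m<n⇒m%n≡m a<g ⟨
    a % g           ≡⟨ [m+kn]%n≡m%n a b g ⟨
    (a + b * g) % g ≡⟨ cong (_% g) eq ⟩
    (c + d * g) % g ≡⟨ [m+kn]%n≡m%n c d g ⟩
    c % g           ≡⟨ m<n⇒m%n≡m c<g ⟩
    c               ∎
  eq′ : a + b * g ≡ a + d * g
  eq′ = trans eq (cong (_+ d * g) (sym a≡c))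

reverse-multiple : ∀ j → ∃[ N ] IsReverseMultiple (2 + j) (1 + j) N
reverse-multiple j =
  _ , (suc j ∷ j ∷ 0 ∷ []) , 1 , digits , (λ ()) , refl , identity
  where
  digits : All (_< 2 + j) (suc j ∷ j ∷ 0 ∷ 1 ∷ [])
  digits = ≤-refl All.∷ n≤1+n (suc j) All.∷ z<s All.∷ s<s z<s All.∷ All.[]
  identity : suc j * (suc j + (2 + j) * (j + (2 + j) * (0 + (2 + j) * (1 + (2 + j) * 0))))
                 ≡ 1 + (2 + j) * (0 + (2 + j) * (j + (2 + j) * (suc j + (2 + j) * 0)))
  identity = solve (j ∷ [])

edge-digits : ∀ k {s r a c t q} → k * a + r ≡ c + q * suc k → a + s * suc k ≡ k * c + t →
              r + a * suc k ≡ (a + c) + q * suc k × (a + c) + s * suc k ≡ t + c * suc k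
edge-digits k {s} {r} {a} {c} {t} {q} eq₁ eq₂ = upper , lower
  where
  open ≡-Reasoning
  upper : r + a * suc k ≡ (a + c) + q * suc k
  upper = begin
    r + a * suc k         ≡⟨ solve (r ∷ a ∷ k ∷ []) ⟩
    (k * a + r) + a       ≡⟨ cong (_+ a) eq₁ ⟩
    (c + q * suc k) + a   ≡⟨ solve (c ∷ q ∷ k ∷ a ∷ []) ⟩
    (a + c) + q * suc k   ∎
  lower : (a + c) + s * suc k ≡ t + c * suc k
  lower = begin
    (a + c) + s * suc k   ≡⟨ solve (a ∷ c ∷ s ∷ k ∷ []) ⟩
    (a + s * suc k) + c   ≡⟨ cong (_+ c) eq₂ ⟩
    (k * c + t) + c       ≡⟨ solve (k ∷ c ∷ t ∷ []) ⟩
    t + c * suc k         ∎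

no-carry-digits : ∀ k {s r a c t q} → r ≤ k → t ≤ k → a + c < suc k →
                  r + a * suc k ≡ (a + c) + q * suc k → (a + c) + s * suc k ≡ t + c * suc k →
                  t ≡ r × c ≡ s × r ≡ s + q
no-carry-digits k {s} {r} {a} {c} r≤k t≤k σ<g upper lower
  with divMod-unique (s≤s r≤k) σ<g upper | divMod-unique σ<g (s≤s t≤k) lower
... | r≡σ , a≡q | σ≡t , s≡c =
  sym (trans r≡σ σ≡t) , sym s≡c , trans r≡σ (trans (+-comm a c) (cong₂ _+_ (sym s≡c) a≡q))

carry-digits : ∀ k {s r a c t q e} → r ≤ k → t ≤ k → a < suc k → c < suc k →
               suc k + e ≡ a + c →
               r + a * suc k ≡ (a + c) + q * suc k → (a + c) + s * suc k ≡ t + c * suc k →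
               t ≡ r × q < k × r + k ≡ suc (s + q)
carry-digits k {s} {r} {a} {c} {t} {q} {e} r≤k t≤k a<g c<g g+e≡σ upper lower
  with divMod-unique (s≤s r≤k) e<g upper′ | divMod-unique e<g (s≤s t≤k) lower′
  where
  open ≡-Reasoning
  e<g : e < suc k
  e<g = +-cancelˡ-< (suc k) e (suc k) (subst (_< suc k + suc k) (sym g+e≡σ) (+-mono-< a<g c<g))
  upper′ : r + a * suc k ≡ e + suc q * suc k
  upper′ = begin
    r + a * suc k             ≡⟨ upper ⟩
    (a + c) + q * suc k       ≡⟨ cong (_+ q * suc k) g+e≡σ ⟨
    (suc k + e) + q * suc k   ≡⟨ solve (k ∷ e ∷ q ∷ []) ⟩
    e + suc q * suc k         ∎
  lower′ : e + suc s * suc k ≡ t + c * suc k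
  lower′ = begin
    e + suc s * suc k         ≡⟨ solve (e ∷ s ∷ k ∷ []) ⟩
    (suc k + e) + s * suc k   ≡⟨ cong (_+ s * suc k) g+e≡σ ⟩
    (a + c) + s * suc k       ≡⟨ lower ⟩
    t + c * suc k             ∎
... | r≡e , a≡1+q | e≡t , 1+s≡c =
  sym (trans r≡e e≡t) , s≤s⁻¹ (subst (_< suc k) a≡1+q a<g) , suc-injective (begin
    suc (r + k)       ≡⟨ cong suc (+-comm r k) ⟩
    suc k + r         ≡⟨ cong (suc k +_) r≡e ⟩
    suc k + e         ≡⟨ g+e≡σ ⟩
    a + c             ≡⟨ cong₂ _+_ a≡1+q (sym 1+s≡c) ⟩
    suc q + suc s     ≡⟨ solve (q ∷ s ∷ []) ⟩
    suc (suc (s + q)) ∎)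
  where open ≡-Reasoning

-- The edges of H(k+1,k) out of x = [s,r]; the constructors record whether the
-- digit sum a + c of the label (c,a) stays below k + 1.
data Step (k : ℕ) (x : Node) : Node → Set where
  no-carry : ∀ {q} → x ≢ start → rOf x ≡ sOf x + q → Step k x (pair (rOf x) q)
  carry    : ∀ {q} → q < k → rOf x + k ≡ suc (sOf x + q) → Step k x (pair (rOf x) q)

edge⇒step : ∀ {k x c a y} → rOf x ≤ k → Edge (suc k) k x c a y → Step k x y
edge⇒step {k} {x} {c} {a} r≤k (a<g , c<g , nonzero , t , q , refl , t≤ , eq₁ , eq₂)
  with edge-digits k {s = sOf x} {q = q} eq₁ eq₂ | a + c <? suc k
... | upper , lower | yes σ<g
  with no-carry-digits k {s = sOf x} r≤k (≤-trans t≤ (m∸n≤m k 1)) σ<g upper lower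
...   | refl , c≡s , r≡s+q =
  no-carry (λ x≡start → proj₂ (nonzero x≡start) (trans c≡s (cong sOf x≡start))) r≡s+q
edge⇒step {k} {x} {c} {a} r≤k (a<g , c<g , nonzero , t , q , refl , t≤ , eq₁ , eq₂)
    | upper , lower | no σ≮g with m≤n⇒∃[o]m+o≡n (≮⇒≥ σ≮g)
... | e , g+e≡σ with carry-digits k {s = sOf x} r≤k (≤-trans t≤ (m∸n≤m k 1)) a<g c<g g+e≡σ upper lower
...   | refl , q<k , r+k≡1+s+q = carry q<k r+k≡1+s+q

no-carry-adj : ∀ {k s r q} → r ≤ k ∸ 1 → r ≡ s + q → Adj (suc k) k (pair s r) (pair r q)
no-carry-adj {k} {s} {_} {q} r≤ refl =
  s , q , q<g , s<g , (λ ()) , s + q , q , refl , r≤ , upper , lower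
  where
  r<g : s + q < suc k
  r<g = s≤s (≤-trans r≤ (m∸n≤m k 1))
  q<g : q < suc k
  q<g = ≤-<-trans (m≤n+m q s) r<g
  s<g : s < suc k
  s<g = ≤-<-trans (m≤m+n s q) r<g
  upper : k * q + (s + q) ≡ s + q * suc k
  upper = solve (k ∷ q ∷ s ∷ [])
  lower : q + s * suc k ≡ k * s + (s + q)
  lower = solve (q ∷ s ∷ k ∷ [])

carry-equations : ∀ k s r q → r + k ≡ suc (s + q) →
                  k * suc q + r ≡ suc s + q * suc k × suc q + s * suc k ≡ k * suc s + r
carry-equations k s r q r+k≡1+s+q = upper , lower
  where
  open ≡-Reasoning
  upper : k * suc q + r ≡ suc s + q * suc k
  upper = begin
    k * suc q + r        ≡⟨ solve (k ∷ q ∷ r ∷ []) ⟩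
    k * q + (r + k)      ≡⟨ cong (k * q +_) r+k≡1+s+q ⟩
    k * q + suc (s + q)  ≡⟨ solve (k ∷ q ∷ s ∷ []) ⟩
    suc s + q * suc k    ∎
  lower : suc q + s * suc k ≡ k * suc s + r
  lower = begin
    suc q + s * suc k    ≡⟨ solve (q ∷ s ∷ k ∷ []) ⟩
    k * s + suc (s + q)  ≡⟨ cong (k * s +_) r+k≡1+s+q ⟨
    k * s + (r + k)      ≡⟨ solve (k ∷ s ∷ r ∷ []) ⟩
    k * suc s + r        ∎

carry-adj : ∀ {k} x {q} → sOf x < k → rOf x ≤ k ∸ 1 → q < k →
            rOf x + k ≡ suc (sOf x + q) → Adj (suc k) k x (pair (rOf x) q)
carry-adj {k} x {q} s<k r≤ q<k r+k≡1+s+q =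
  suc (sOf x) , suc q , s≤s q<k , s≤s s<k , (λ _ → (λ ()) , (λ ())) ,
  rOf x , q , refl , r≤ , carry-equations k (sOf x) (rOf x) q r+k≡1+s+q

module YoungGraph (m : ℕ) where
  j = suc m
  k = suc j
  g = suc k

  node : N1089 → Node
  node S = start
  node U = pair 0 0
  node V = pair 0 j
  node W = pair j j
  node X = pair j 0

  label : Node → N1089
  label start                = S
  label (pair zero zero)     = U
  label (pair zero (suc _))  = V
  label (pair (suc _) (suc _)) = W
  label (pair (suc _) zero)  = X

  label-node : ∀ i → label (node i) ≡ i
  label-node S = refl
  label-node U = refl
  label-node V = refl
  label-node W = refl
  label-node X = refl

  node-injective : ∀ i i′ → node i ≡ node i′ → i ≡ i′
  node-injective i i′ eq = trans (sym (label-node i)) (trans (cong label eq) (label-node i′))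

  r≤k : ∀ i → rOf (node i) ≤ k
  r≤k S = z≤n
  r≤k U = z≤n
  r≤k V = n≤1+n j
  r≤k W = n≤1+n j
  r≤k X = z≤n

  step⇒edge1089 : ∀ i {y} → Step k (node i) y → ∃[ i′ ] E1089 i i′ × node i′ ≡ y
  step⇒edge1089 S (no-carry not-start _) = ⊥-elim (not-start refl)
  step⇒edge1089 S (carry _ refl)         = V , SV , refl
  step⇒edge1089 U (no-carry _ refl)      = U , UU , refl
  step⇒edge1089 U (carry _ refl)         = V , UV , refl
  step⇒edge1089 V (no-carry _ refl)      = W , VW , refl
  step⇒edge1089 V (carry q<k eq)         = ⊥-elim (m+n≮n m k (subst (_≤ k) (sym eq) q<k))
  step⇒edge1089 W (no-carry _ eq)        =
    X , WX , cong (pair j) (+-cancelˡ-≡ j 0 _ (trans (+-identityʳ j) eq))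
  step⇒edge1089 W (carry _ eq)           =
    W , WW , cong (pair j) (+-cancelˡ-≡ j j _ (suc-injective (trans (sym (+-suc j j)) eq)))
  step⇒edge1089 X (no-carry _ ())
  step⇒edge1089 X (carry _ eq)           =
    U , XU , cong (pair 0) (+-cancelˡ-≡ j 0 _ (trans (+-identityʳ j) (suc-injective eq)))

  successor : ∀ i {y} → Adj g k (node i) y → ∃[ i′ ] E1089 i i′ × node i′ ≡ y
  successor i (_ , _ , e) = step⇒edge1089 i (edge⇒step (r≤k i) e)

  edge : ∀ {i i′} → E1089 i i′ → Adj g k (node i) (node i′)
  edge SV = carry-adj start z<s z≤n ≤-refl refl
  edge UU = no-carry-adj z≤n refl
  edge UV = carry-adj (pair 0 0) z<s z≤n ≤-refl refl
  edge VW = no-carry-adj ≤-refl refl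
  edge WW = carry-adj (pair j j) ≤-refl ≤-refl ≤-refl (+-suc j j)
  edge WX = no-carry-adj ≤-refl (sym (+-identityʳ j))
  edge XU = carry-adj (pair j 0) ≤-refl z≤n z<s (cong suc (sym (+-identityʳ j)))

  adjacent⇔ : ∀ i i′ → E1089 i i′ ⇔ Adj g k (node i) (node i′)
  adjacent⇔ i i′ = mk⇔ edge from
    where
    from : Adj g k (node i) (node i′) → E1089 i i′
    from adj with successor i adj
    ... | i″ , e , eq = subst (E1089 i) (node-injective i″ i′ eq) e

  Image : Node → Set
  Image x = ∃[ i ] node i ≡ x

  image-closed : ∀ {x y} → Path g k x y → Image x → Image y
  image-closed = fold (λ x y → Image x → Image y) extend (λ img → img)
    where
    extend : ∀ {x y z} → Adj g k x y → (Image y → Image z) → Image x → Image z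
    extend adj onward (i , refl) with successor i adj
    ... | i′ , _ , eq = onward (i′ , eq)

  reachable : ∀ i → InH g k (node i)
  reachable S = ε
  reachable V = edge SV ◅ ε
  reachable W = edge SV ◅ edge VW ◅ ε
  reachable X = edge SV ◅ edge VW ◅ edge WX ◅ ε
  reachable U = edge SV ◅ edge VW ◅ edge WX ◅ edge XU ◅ ε

  reaches-W : ∀ i → Path g k (node i) (node W)
  reaches-W S = edge SV ◅ edge VW ◅ ε
  reaches-W U = edge UV ◅ edge VW ◅ ε
  reaches-W V = edge VW ◅ ε
  reaches-W W = ε
  reaches-W X = edge XU ◅ edge UV ◅ edge VW ◅ ε

  inYoung : ∀ i → InYoung g k (node i)
  inYoung i = reachable i , node W , reaches-W i , inj₁ (reachable W , j , refl)

  even⇔ : ∀ i → Even1089 i ⇔ EvenPivot g k (node i)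
  even⇔ i = mk⇔ to (from i)
    where
    to : Even1089 i → EvenPivot g k (node i)
    to evU = reachable U , 0 , refl
    to evW = reachable W , j , refl
    from : ∀ i → EvenPivot g k (node i) → Even1089 i
    from S (_ , _ , ())
    from U _ = evU
    from V (_ , _ , ())
    from W _ = evW
    from X (_ , _ , ())

  odd⇔ : ∀ i → Odd1089 i ⇔ OddPivot g k (node i)
  odd⇔ i = mk⇔ to (from i)
    where
    to : Odd1089 i → OddPivot g k (node i)
    to odU = reachable U , inj₁ (0 , refl , edge UU)
    to odW = reachable W , inj₁ (j , refl , edge WW)
    from : ∀ i → OddPivot g k (node i) → Odd1089 i
    from S (_ , inj₁ (_ , () , _))
    from S (_ , inj₂ (_ , _ , _ , () , _))
    from U _ = odU
    from V (_ , inj₁ (_ , () , _))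
    from V (_ , inj₂ (_ , _ , _ , refl , adj)) with Equivalence.from (adjacent⇔ V X) adj
    ... | ()
    from W _ = odW
    from X (_ , inj₁ (_ , () , _))
    from X (_ , inj₂ (_ , _ , _ , refl , adj)) with Equivalence.from (adjacent⇔ X V) adj
    ... | ()

  young-exists : YoungExists g k
  young-exists = inj₁ (j , (λ ()) , reachable W)

  is-1089-graph : IsThe1089Graph g k
  is-1089-graph =
    node , inYoung , node-injective ,
    (λ _ (path , _) → image-closed path (S , refl)) ,
    adjacent⇔ , refl , even⇔ , odd⇔

theorem3 : (g : ℕ) → 3 ≤ g →
    (∃[ N ] IsReverseMultiple g (g ∸ 1) N) × YoungExists g (g ∸ 1) × IsThe1089Graph g (g ∸ 1)
theorem3 (suc (suc (suc m))) (s≤s (s≤s (s≤s z≤n))) =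
  reverse-multiple (suc m) , young-exists , is-1089-graph
  where open YoungGraph m
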